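{- Fix $n\in\mathbb{N}$ and let $\mathcal P$ be as in the context. Let $j\in[1,4]$, let $\alpha$ be a monomial with $c_{jn}s_n+\alpha\in\langle\mathcal P\rangle$, and let $k=\mathrm{height}(\alpha)$. Then: (1) for every $m$ with $k\le m\le n$ there is a unique $l\in[1,4]$ such that $c_{lm}$ divides $\alpha$; (2) for every $m$ with $k<m\le n$ there is a unique $l\in[1,4]$ such that $q_{lm}$ divides $\alpha$; (3) there is $x\in\{s_k,f_k\}$ such that $x$ divides $\alpha$ and, for every $y\in\{s_k,f_k\}$, $xy$ does not divide $\alpha$; and for every $m\neq k$, neither $s_m$ nor $f_m$ divides $\alpha$.
   Context: $\mathbb{Z}_2$ is the field with two elements; $\langle\mathcal P\rangle$ is the ideal generated by $\mathcal P$ in the polynomial ring over $\mathbb{Z}_2$ in distinct variables $s_i,f_i,q_{ki},c_{ki},b_{ki}$ ($i\in\{0,\dots,n\}$, $k\in\{1,2,3,4\}$) (possibly together with further variables). $\mathcal P=\bigcup_{m=0}^{n}\mathcal P_m$, where $\mathcal P_0=\{b_{i0}^2c_{i0}f_0+c_{i0}s_0 : i\in\{1,2,3,4\}\}$ and, for $1\le m\le n$, $\mathcal P_m$ consists of $q_{1m}c_{1(m-1)}s_{m-1}+s_m$; $q_{2m}c_{2(m-1)}s_{m-1}+q_{1m}b_{1(m-1)}c_{1(m-1)}f_{m-1}$; $q_{3m}c_{3(m-1)}f_{m-1}+q_{2m}c_{2(m-1)}f_{m-1}$; $q_{3m}b_{1(m-1)}c_{3(m-1)}s_{m-1}+q_{2m}b_{4(m-1)}c_{2(m-1)}s_{m-1}$;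 $q_{4m}b_{4(m-1)}c_{4(m-1)}f_{m-1}+q_{3m}c_{3(m-1)}s_{m-1}$; $q_{4m}c_{4(m-1)}s_{m-1}+f_m$; and $q_{2m}b_{3(m-1)}b_{im}c_{im}f_{m-1}+q_{2m}b_{2(m-1)}c_{im}f_{m-1}$ for $i\in\{1,2,3,4\}$. For a monomial $\alpha$, $\mathrm{height}(\alpha)=\min\{i : \exists k\in[1,4],\ c_{ki}\text{ divides }\alpha\}$ (this is well defined for the $\alpha$ in question). -}

module Defs where

open import Data.Nat using (ℕ; zero; suc; _≤_; _<_)
open import Data.Fin using (Fin)
open import Data.List using (List; []; _∷_; _++_; map; concatMap)
open import Data.Product using (Σ; _×_; _,_)
open import Relation.Binary.PropositionalEquality using (_≡_)
open import Data.List.Relation.Binary.Permutation.Propositional using (_↭_)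

-- The "k" index k ∈ {1,2,3,4}
-- is encoded by Fin 4 (Fin.zero ↦ 1, ..., ↦ 4); the level index i is a ℕ.
-- Indexing levels by all of ℕ and adding the countably many `other`
-- variables realises "possibly together with further variables".
data Var : Set where
  s f   : ℕ → Var
  q c b : Fin 4 → ℕ → Var
  other : ℕ → Var

k₁ k₂ k₃ k₄ : Fin 4
k₁ = Fin.zero
k₂ = Fin.suc Fin.zero
k₃ = Fin.suc (Fin.suc Fin.zero)
k₄ = Fin.suc (Fin.suc (Fin.suc Fin.zero))

-- A monomial is a formal product of variables (a list, equal up to permutation).
Mono : Set
Mono = List Var

-- A polynomial over ℤ₂ is a formal sum of monomials (coefficients in ℤ₂).
Poly : Set
Poly = List Mono

-- A formal sum is zero in ℤ₂[Var] iff its monomials can be paired off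
-- into equal monomials (equal up to reordering the variables).
data IsZero : Poly → Set where
  nil  : IsZero []
  pair : ∀ {m m' L} → m ↭ m' → IsZero L → IsZero (m ∷ m' ∷ L)
  perm : ∀ {L L'} → L ↭ L' → IsZero L → IsZero L'

-- Index set of the generating set 𝒫 = ⋃ 𝒫_m.  For 1 ≤ m ≤ n we write
-- m = suc p with p < n (p plays the role of m-1).
data Gen (n : ℕ) : Set where
  gen0 : Fin 4 → Gen n
  gen1 gen2 gen3 gen4 gen5 gen6 : (p : ℕ) → p < n → Gen n
  gen7 : (p : ℕ) → p < n → Fin 4 → Gen n

gen : ∀ {n} → Gen n → Poly
gen (gen0 i) = (b i 0 ∷ b i 0 ∷ c i 0 ∷ f 0 ∷ []) ∷ (c i 0 ∷ s 0 ∷ []) ∷ []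
gen (gen1 p _) = (q k₁ (suc p) ∷ c k₁ p ∷ s p ∷ []) ∷ (s (suc p) ∷ []) ∷ []
gen (gen2 p _) = (q k₂ (suc p) ∷ c k₂ p ∷ s p ∷ [])
               ∷ (q k₁ (suc p) ∷ b k₁ p ∷ c k₁ p ∷ f p ∷ []) ∷ []
gen (gen3 p _) = (q k₃ (suc p) ∷ c k₃ p ∷ f p ∷ [])
               ∷ (q k₂ (suc p) ∷ c k₂ p ∷ f p ∷ []) ∷ []
gen (gen4 p _) = (q k₃ (suc p) ∷ b k₁ p ∷ c k₃ p ∷ s p ∷ [])
               ∷ (q k₂ (suc p) ∷ b k₄ p ∷ c k₂ p ∷ s p ∷ []) ∷ []
gen (gen5 p _) = (q k₄ (suc p) ∷ b k₄ p ∷ c k₄ p ∷ f p ∷ [])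
               ∷ (q k₃ (suc p) ∷ c k₃ p ∷ s p ∷ []) ∷ []
gen (gen6 p _) = (q k₄ (suc p) ∷ c k₄ p ∷ s p ∷ []) ∷ (f (suc p) ∷ []) ∷ []
gen (gen7 p _ i) = (q k₂ (suc p) ∷ b k₃ p ∷ b i (suc p) ∷ c i (suc p) ∷ f p ∷ [])
                 ∷ (q k₂ (suc p) ∷ b k₂ p ∷ c i (suc p) ∷ f p ∷ []) ∷ []

_·_ : Mono → Poly → Poly
t · P = map (t ++_) P

-- Ideal membership: F ∈ ⟨𝒫⟩ iff F = Σ tᵢ·gᵢ for finitely many monomials tᵢ
-- and generators gᵢ ∈ 𝒫 (over ℤ₂, F - Σ = F + Σ).
InIdeal : ℕ → Poly → Set
InIdeal n F = Σ (List (Mono × Gen n)) λ ts →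
  IsZero (F ++ concatMap (λ { (t , g) → t · gen g }) ts)

_∣ₘ_ : Mono → Mono → Set
x ∣ₘ α = Σ Mono λ β → (x ++ β) ↭ α

IsHeight : Mono → ℕ → Set
IsHeight α k = Σ (Fin 4) (λ l → (c l k ∷ []) ∣ₘ α)
             × (∀ i l → (c l i ∷ []) ∣ₘ α → k ≤ i)

UniqueFin4 : (Fin 4 → Set) → Set
UniqueFin4 P = Σ (Fin 4) λ l → P l × (∀ l' → P l' → l' ≡ l)

{-# OPTIONS --safe #-}
-- Call w : Var → ℕ a grading if every generator in 𝒫 is a binomial whose two
-- monomials have the same w-weight.  Over ℤ₂ every element of ⟨𝒫⟩ then has an
-- even number of monomials of each weight, so c_{jn} s_n + α ∈ ⟨𝒫⟩ forces α to
-- have the weight of c_{jn} s_n for every grading.  Three gradings suffice: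
--   * the s,f-degree, which is 1, so α = x β with x ∈ {s_k, f_k} and β free of s, f;
--   * for each level i: the c's of level i, plus [i < m] for each s_m, f_m,
--     so that #{c_{·i} in α} + [i < k] = [i ≤ n];
--   * for each level i: the q's of level i, plus [i ≤ m] for each s_m, f_m,
--     so that #{q_{·i} in α} + [i ≤ k] = [i ≤ n].
-- For i = k the last equation gives k ≤ n; for k ≤ i ≤ n (resp. k < i ≤ n) the
-- counts are 1, and for i < k the count of c's is 0, which makes k the height.
module Submission where

open import Defs
open import Data.Nat using (ℕ; _≤_; _<_)
open import Data.Fin using (Fin)
open import Data.List using (List; []; _∷_)
open import Data.Product using (Σ; _×_)
open import Data.Sum using (_⊎_)
open import Relation.Binary.PropositionalEquality using (_≡_; _≢_)
open import Relation.Nullary using (¬_)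

open import Algebra.Bundles using (CommutativeMonoid; CommutativeRing)
open import Data.Bool using (Bool; true; false; T; _xor_)
open import Data.Bool.Properties using (xor-assoc; xor-same; xor-identityʳ; xor-∧-commutativeRing)
open import Data.Empty using (⊥; ⊥-elim)
open import Data.List using (map; foldr; _++_; concatMap)
open import Data.List.Properties using (map-++)
open import Data.List.Membership.Propositional using (_∈_; _∉_)
open import Data.List.Relation.Unary.Any using (here; there)
open import Data.List.Relation.Binary.Permutation.Propositional
  using (_↭_; ↭-refl; ↭-sym; ↭-trans; ↭-swap; ↭-prep; ↭⇒↭ₛ)
open import Data.List.Relation.Binary.Permutation.Propositional.Properties
  using (map⁺; ∈-resp-↭; drop-∷)
open import Data.List.Relation.Binary.Permutation.Setoid.Properties using (foldr-commMonoid)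
open import Data.Nat using (zero; suc; _+_; _≡ᵇ_; _<ᵇ_; z≤n; s≤s; s≤s⁻¹)
open import Data.Nat.ListAction using (sum)
open import Data.Nat.ListAction.Properties using (sum-++; sum-↭)
open import Data.Nat.Properties
  using ( +-identityʳ; +-cancelʳ-≤; m≤n+m; n≤0⇒n≡0; m+n≡0⇒m≡0; m+n≡0⇒n≡0; suc-injective
        ; ≡⇒≡ᵇ; ≡ᵇ⇒≡; <⇒<ᵇ; <ᵇ⇒<; <⇒≢; <⇒≱; ≮⇒≥; ≤-refl; ≤-reflexive; ≤-trans; n<1+n
        ; +-commutativeSemigroup )
open import Algebra.Properties.CommutativeSemigroup +-commutativeSemigroup using (interchange)
open import Data.Product using (_,_; proj₁; proj₂; ∃; ∃₂)
open import Data.Sum using (inj₁; inj₂)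
open import Function.Base using (_∘_)
open import Function.Definitions using (Injective)
open import Relation.Binary.PropositionalEquality
  using (refl; sym; trans; cong; cong₂; subst; module ≡-Reasoning)

𝟙 : Bool → ℕ
𝟙 true = 1
𝟙 false = 0

T⇒𝟙≡1 : ∀ {b} → T b → 𝟙 b ≡ 1
T⇒𝟙≡1 {true} _ = refl

¬T⇒𝟙≡0 : ∀ {b} → ¬ T b → 𝟙 b ≡ 0
¬T⇒𝟙≡0 {true} ¬t = ⊥-elim (¬t _)
¬T⇒𝟙≡0 {false} _ = refl

0<𝟙⇒T : ∀ {b} → 0 < 𝟙 b → T b
0<𝟙⇒T {true} _ = _

𝟙≤1 : ∀ b → 𝟙 b ≤ 1
𝟙≤1 true = s≤s z≤n
𝟙≤1 false = z≤n

𝟙[i≡m]+𝟙[i<m]≡𝟙[i<1+m] : ∀ i m → 𝟙 (i ≡ᵇ m) + 𝟙 (i <ᵇ m) ≡ 𝟙 (i <ᵇ suc m)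
𝟙[i≡m]+𝟙[i<m]≡𝟙[i<1+m] zero zero = refl
𝟙[i≡m]+𝟙[i<m]≡𝟙[i<1+m] zero (suc m) = refl
𝟙[i≡m]+𝟙[i<m]≡𝟙[i<1+m] (suc i) zero = refl
𝟙[i≡m]+𝟙[i<m]≡𝟙[i<1+m] (suc i) (suc m) = 𝟙[i≡m]+𝟙[i<m]≡𝟙[i<1+m] i m

module _ {x i a b : ℕ} (count : x + 𝟙 (i <ᵇ a) ≡ 𝟙 (i <ᵇ b)) where

  between⇒≡1 : a ≤ i → i < b → x ≡ 1
  between⇒≡1 a≤i i<b = begin
    x               ≡⟨ +-identityʳ x ⟨
    x + 0           ≡⟨ cong (x +_) (¬T⇒𝟙≡0 λ i<ᵇa → <⇒≱ (<ᵇ⇒< i a i<ᵇa) a≤i) ⟨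
    x + 𝟙 (i <ᵇ a)  ≡⟨ count ⟩
    𝟙 (i <ᵇ b)      ≡⟨ T⇒𝟙≡1 (<⇒<ᵇ i<b) ⟩
    1               ∎
    where open ≡-Reasoning

  private
    x+1≡𝟙[i<b] : i < a → x + 1 ≡ 𝟙 (i <ᵇ b)
    x+1≡𝟙[i<b] i<a = trans (cong (x +_) (sym (T⇒𝟙≡1 (<⇒<ᵇ i<a)))) count

  below⇒≡0 : i < a → x ≡ 0
  below⇒≡0 i<a = n≤0⇒n≡0 (+-cancelʳ-≤ 1 x 0 (≤-trans (≤-reflexive (x+1≡𝟙[i<b] i<a)) (𝟙≤1 _)))

  below⇒< : i < a → i < b
  below⇒< i<a = <ᵇ⇒< i b (0<𝟙⇒T (≤-trans (m≤n+m 1 x) (≤-reflexive (x+1≡𝟙[i<b] i<a))))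

weight : (Var → ℕ) → Mono → ℕ
weight w α = sum (map w α)

weight-++ : ∀ w α β → weight w (α ++ β) ≡ weight w α + weight w β
weight-++ w α β = trans (cong sum (map-++ w α β)) (sum-++ (map w α) (map w β))

weight-↭ : ∀ w {α β} → α ↭ β → weight w α ≡ weight w β
weight-↭ w α↭β = sum-↭ (map⁺ w α↭β)

weight-+ : ∀ w v α → weight (λ x → w x + v x) α ≡ weight w α + weight v α
weight-+ w v [] = refl
weight-+ w v (x ∷ α) =
  trans (cong (w x + v x +_) (weight-+ w v α)) (interchange (w x) (v x) (weight w α) (weight v α))

weight≡0⇒∉ : ∀ w {x α} → weight w α ≡ 0 → 0 < w x → x ∉ α
weight≡0⇒∉ w {α = y ∷ α} wα≡0 0<wy (here refl) = <⇒≢ 0<wy (sym (m+n≡0⇒m≡0 (w y) wα≡0))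
weight≡0⇒∉ w {α = y ∷ α} wα≡0 0<wx (there x∈α) = weight≡0⇒∉ w (m+n≡0⇒n≡0 (w y) wα≡0) 0<wx x∈α

weight≡1⇒split : ∀ w α → weight w α ≡ 1 → ∃₂ λ x β → x ∷ β ↭ α × w x ≡ 1 × weight w β ≡ 0
weight≡1⇒split w (y ∷ α) wα≡1 with w y in wy≡
... | 1 = y , α , ↭-refl , wy≡ , suc-injective wα≡1
... | 0 with weight≡1⇒split w α wα≡1
...   | x , β , x∷β↭α , wx≡1 , wβ≡0 =
  x , y ∷ β , ↭-trans (↭-swap x y ↭-refl) (↭-prep y x∷β↭α) , wx≡1 , trans (cong (_+ weight w β) wy≡) wβ≡0

∣ₘ⇒∈ : ∀ {x α} → (x ∷ []) ∣ₘ α → x ∈ α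
∣ₘ⇒∈ (_ , x∷β↭α) = ∈-resp-↭ x∷β↭α (here refl)

split-unique : ∀ w {x β α y} → x ∷ β ↭ α → weight w β ≡ 0 → 0 < w y → y ∈ α → y ≡ x
split-unique w x∷β↭α wβ≡0 0<wy y∈α with ∈-resp-↭ (↭-sym x∷β↭α) y∈α
... | here y≡x = y≡x
... | there y∈β = ⊥-elim (weight≡0⇒∉ w wβ≡0 0<wy y∈β)

weight≡1⇒UniqueFin4 : ∀ w (v : Fin 4 → Var) → Injective _≡_ _≡_ v →
  (∀ l → 0 < w (v l)) → (∀ {x} → 0 < w x → ∃ λ l → x ≡ v l) →
  ∀ {α} → weight w α ≡ 1 → UniqueFin4 (λ l → (v l ∷ []) ∣ₘ α)
weight≡1⇒UniqueFin4 w v v-injective 0<w∘v w-support {α} wα≡1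
  with weight≡1⇒split w α wα≡1
... | x , β , x∷β↭α , wx≡1 , wβ≡0 with w-support (≤-reflexive (sym wx≡1))
...   | l , refl = l , (β , x∷β↭α) , unique
  where
  unique : ∀ l′ → (v l′ ∷ []) ∣ₘ α → l′ ≡ l
  unique l′ vl′∣α = v-injective (split-unique w x∷β↭α wβ≡0 (0<w∘v l′) (∣ₘ⇒∈ vl′∣α))

parity : (Mono → Bool) → Poly → Bool
parity φ P = foldr _xor_ false (map φ P)

parity-++ : ∀ φ P Q → parity φ (P ++ Q) ≡ parity φ P xor parity φ Q
parity-++ φ [] Q = refl
parity-++ φ (m ∷ P) Q = trans (cong (φ m xor_) (parity-++ φ P Q)) (sym (xor-assoc (φ m) _ _))

parity-↭ : ∀ φ {P Q} → P ↭ Q → parity φ P ≡ parity φ Q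
parity-↭ φ P↭Q = foldr-commMonoid XOR.setoid XOR.isCommutativeMonoid (↭⇒↭ₛ (map⁺ φ P↭Q))
  where module XOR = CommutativeMonoid (CommutativeRing.+-commutativeMonoid xor-∧-commutativeRing)

parity-IsZero : ∀ φ → (∀ {m m′} → m ↭ m′ → φ m ≡ φ m′) → ∀ {P} → IsZero P → parity φ P ≡ false
parity-IsZero φ φ-↭ nil = refl
parity-IsZero φ φ-↭ (pair {m} {m′} {P} m↭m′ zero-P) = begin
  φ m xor (φ m′ xor parity φ P)   ≡⟨ xor-assoc (φ m) _ _ ⟨
  (φ m xor φ m′) xor parity φ P   ≡⟨ cong (λ b → (b xor φ m′) xor parity φ P) (φ-↭ m↭m′) ⟩
  (φ m′ xor φ m′) xor parity φ P  ≡⟨ cong (_xor parity φ P) (xor-same (φ m′)) ⟩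
  parity φ P                      ≡⟨ parity-IsZero φ φ-↭ zero-P ⟩
  false                           ∎
  where open ≡-Reasoning
parity-IsZero φ φ-↭ (perm P↭Q zero-P) = trans (sym (parity-↭ φ P↭Q)) (parity-IsZero φ φ-↭ zero-P)

parity-concatMap : ∀ φ {A : Set} (G : A → Poly) → (∀ a → parity φ (G a) ≡ false) →
  ∀ as → parity φ (concatMap G as) ≡ false
parity-concatMap φ G parity-G [] = refl
parity-concatMap φ G parity-G (a ∷ as) = begin
  parity φ (G a ++ concatMap G as)              ≡⟨ parity-++ φ (G a) (concatMap G as) ⟩
  parity φ (G a) xor parity φ (concatMap G as)  ≡⟨ cong₂ _xor_ (parity-G a) (parity-concatMap φ G parity-G as) ⟩
  false                                         ∎
  where open ≡-Reasoning

parity-binomial : ∀ φ m m′ → parity φ (m ∷ m′ ∷ []) ≡ false → φ m ≡ φ m′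
parity-binomial φ m m′ parity≡false with φ m | φ m′
... | true  | true  = refl
... | false | false = refl

HomogeneousBinomial : (Var → ℕ) → Poly → Set
HomogeneousBinomial w (m ∷ m′ ∷ []) = weight w m ≡ weight w m′
HomogeneousBinomial w _ = ⊥

HomogeneousGenerators : (Var → ℕ) → Set
HomogeneousGenerators w = ∀ {n} (g : Gen n) → HomogeneousBinomial w (gen g)

hasWeight : (Var → ℕ) → ℕ → Mono → Bool
hasWeight w d α = weight w α ≡ᵇ d

module _ {w : Var → ℕ} (homogeneous : HomogeneousGenerators w) where

  private
    parity-multiple : ∀ d t P → HomogeneousBinomial w P → parity (hasWeight w d) (t · P) ≡ false
    parity-multiple d t (m ∷ m′ ∷ []) wm≡wm′ = begin
      φ (t ++ m) xor (φ (t ++ m′) xor false)   ≡⟨ cong (λ b → b xor (φ (t ++ m′) xor false)) φ[tm]≡φ[tm′] ⟩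
      φ (t ++ m′) xor (φ (t ++ m′) xor false)  ≡⟨ xor-assoc (φ (t ++ m′)) _ false ⟨
      (φ (t ++ m′) xor φ (t ++ m′)) xor false  ≡⟨ cong (_xor false) (xor-same (φ (t ++ m′))) ⟩
      false                                    ∎
      where
      open ≡-Reasoning
      φ : Mono → Bool
      φ = hasWeight w d
      φ[tm]≡φ[tm′] : φ (t ++ m) ≡ φ (t ++ m′)
      φ[tm]≡φ[tm′] = cong (_≡ᵇ d) (begin
        weight w (t ++ m)         ≡⟨ weight-++ w t m ⟩
        weight w t + weight w m   ≡⟨ cong (weight w t +_) wm≡wm′ ⟩
        weight w t + weight w m′  ≡⟨ weight-++ w t m′ ⟨
        weight w (t ++ m′)        ∎)

  InIdeal⇒parity≡false : ∀ {n F} d → InIdeal n F → parity (hasWeight w d) F ≡ false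
  InIdeal⇒parity≡false {n} {F} d (ts , F+Σ≡0) = begin
    parity φ F                                ≡⟨ xor-identityʳ (parity φ F) ⟨
    parity φ F xor false                      ≡⟨ cong (parity φ F xor_) (parity-concatMap φ _ multiples≡false ts) ⟨
    parity φ F xor parity φ (concatMap _ ts)  ≡⟨ parity-++ φ F _ ⟨
    parity φ (F ++ concatMap _ ts)            ≡⟨ parity-IsZero φ (cong (_≡ᵇ d) ∘ weight-↭ w) F+Σ≡0 ⟩
    false                                     ∎
    where
    open ≡-Reasoning
    φ : Mono → Bool
    φ = hasWeight w d
    multiples≡false : ∀ (tg : Mono × Gen n) → parity φ (proj₁ tg · gen (proj₂ tg)) ≡ false
    multiples≡false (t , g) = parity-multiple d t (gen g) (homogeneous g)

  InIdeal⇒weight≡ : ∀ {n m m′} → InIdeal n (m ∷ m′ ∷ []) → weight w m ≡ weight w m′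
  InIdeal⇒weight≡ {m = m} {m′} m+m′∈ =
    sym (≡ᵇ⇒≡ (weight w m′) (weight w m) (subst T φm≡φm′ (≡⇒≡ᵇ (weight w m) (weight w m) refl)))
    where
    φm≡φm′ : hasWeight w (weight w m) m ≡ hasWeight w (weight w m) m′
    φm≡φm′ = parity-binomial (hasWeight w (weight w m)) m m′ (InIdeal⇒parity≡false (weight w m) m+m′∈)

sfWeight : (ℕ → ℕ) → Var → ℕ
sfWeight g (s m) = g m
sfWeight g (f m) = g m
sfWeight g _ = 0

cWeight : ℕ → Var → ℕ
cWeight i (c _ m) = 𝟙 (i ≡ᵇ m)
cWeight i _ = 0

qWeight : ℕ → Var → ℕ
qWeight i (q _ m) = 𝟙 (i ≡ᵇ m)
qWeight i _ = 0

sfDegree : Var → ℕ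
sfDegree = sfWeight λ _ → 1

cLevel : ℕ → Var → ℕ
cLevel i x = cWeight i x + sfWeight (λ m → 𝟙 (i <ᵇ m)) x

qLevel : ℕ → Var → ℕ
qLevel i x = qWeight i x + sfWeight (λ m → 𝟙 (i <ᵇ suc m)) x

private
  level-step : ∀ i m → (𝟙 (i ≡ᵇ m) + 0) + (𝟙 (i <ᵇ m) + 0) ≡ 𝟙 (i <ᵇ suc m) + 0
  level-step i m = begin
    (𝟙 (i ≡ᵇ m) + 0) + (𝟙 (i <ᵇ m) + 0)  ≡⟨ cong₂ _+_ (+-identityʳ (𝟙 (i ≡ᵇ m))) (+-identityʳ (𝟙 (i <ᵇ m))) ⟩
    𝟙 (i ≡ᵇ m) + 𝟙 (i <ᵇ m)              ≡⟨ 𝟙[i≡m]+𝟙[i<m]≡𝟙[i<1+m] i m ⟩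
    𝟙 (i <ᵇ suc m)                       ≡⟨ +-identityʳ _ ⟨
    𝟙 (i <ᵇ suc m) + 0                   ∎
    where open ≡-Reasoning

cLevel-c∷s≡s : ∀ i l m → weight (cLevel i) (c l m ∷ s m ∷ []) ≡ weight (cLevel i) (s (suc m) ∷ [])
cLevel-c∷s≡s i l m = level-step i m

qLevel-q∷s≡s : ∀ i l m → weight (qLevel i) (q l (suc m) ∷ s m ∷ []) ≡ weight (qLevel i) (s (suc m) ∷ [])
qLevel-q∷s≡s i l m = level-step i (suc m)

sfDegree-homogeneous : HomogeneousGenerators sfDegree
sfDegree-homogeneous (gen0 _) = refl
sfDegree-homogeneous (gen1 _ _) = refl
sfDegree-homogeneous (gen2 _ _) = refl
sfDegree-homogeneous (gen3 _ _) = refl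
sfDegree-homogeneous (gen4 _ _) = refl
sfDegree-homogeneous (gen5 _ _) = refl
sfDegree-homogeneous (gen6 _ _) = refl
sfDegree-homogeneous (gen7 _ _ _) = refl

cLevel-homogeneous : ∀ i → HomogeneousGenerators (cLevel i)
cLevel-homogeneous i (gen0 _) = refl
cLevel-homogeneous i (gen1 p _) = cLevel-c∷s≡s i k₁ p
cLevel-homogeneous i (gen2 _ _) = refl
cLevel-homogeneous i (gen3 _ _) = refl
cLevel-homogeneous i (gen4 _ _) = refl
cLevel-homogeneous i (gen5 _ _) = refl
cLevel-homogeneous i (gen6 p _) = cLevel-c∷s≡s i k₄ p
cLevel-homogeneous i (gen7 _ _ _) = refl

qLevel-homogeneous : ∀ i → HomogeneousGenerators (qLevel i)
qLevel-homogeneous i (gen0 _) = refl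
qLevel-homogeneous i (gen1 p _) = qLevel-q∷s≡s i k₁ p
qLevel-homogeneous i (gen2 _ _) = refl
qLevel-homogeneous i (gen3 _ _) = refl
qLevel-homogeneous i (gen4 _ _) = refl
qLevel-homogeneous i (gen5 _ _) = refl
qLevel-homogeneous i (gen6 p _) = qLevel-q∷s≡s i k₄ p
qLevel-homogeneous i (gen7 _ _ _) = refl

cWeight-positive : ∀ m l → 0 < cWeight m (c l m)
cWeight-positive m l = ≤-reflexive (sym (T⇒𝟙≡1 (≡⇒≡ᵇ m m refl)))

qWeight-positive : ∀ m l → 0 < qWeight m (q l m)
qWeight-positive m l = ≤-reflexive (sym (T⇒𝟙≡1 (≡⇒≡ᵇ m m refl)))

cWeight-support : ∀ {m x} → 0 < cWeight m x → ∃ λ l → x ≡ c l m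
cWeight-support {m} {c l m′} 0<w = l , cong (c l) (sym (≡ᵇ⇒≡ m m′ (0<𝟙⇒T 0<w)))

qWeight-support : ∀ {m x} → 0 < qWeight m x → ∃ λ l → x ≡ q l m
qWeight-support {m} {q l m′} 0<w = l , cong (q l) (sym (≡ᵇ⇒≡ m m′ (0<𝟙⇒T 0<w)))

sfDegree-support : ∀ {x} → sfDegree x ≡ 1 → ∃ λ k → x ≡ s k ⊎ x ≡ f k
sfDegree-support {s k} _ = k , inj₁ refl
sfDegree-support {f k} _ = k , inj₂ refl

sfWeight-sf : ∀ g {x k} → x ≡ s k ⊎ x ≡ f k → sfWeight g x ≡ g k
sfWeight-sf g (inj₁ refl) = refl
sfWeight-sf g (inj₂ refl) = refl

sfDegree≡0⇒sfWeight≡0 : ∀ g β → weight sfDegree β ≡ 0 → weight (sfWeight g) β ≡ 0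
sfDegree≡0⇒sfWeight≡0 g [] _ = refl
sfDegree≡0⇒sfWeight≡0 g (q _ _ ∷ β) wβ≡0 = sfDegree≡0⇒sfWeight≡0 g β wβ≡0
sfDegree≡0⇒sfWeight≡0 g (c _ _ ∷ β) wβ≡0 = sfDegree≡0⇒sfWeight≡0 g β wβ≡0
sfDegree≡0⇒sfWeight≡0 g (b _ _ ∷ β) wβ≡0 = sfDegree≡0⇒sfWeight≡0 g β wβ≡0
sfDegree≡0⇒sfWeight≡0 g (other _ ∷ β) wβ≡0 = sfDegree≡0⇒sfWeight≡0 g β wβ≡0

sf-level-unique : ∀ {x y k m} → x ≡ s k ⊎ x ≡ f k → y ≡ s m ⊎ y ≡ f m → y ≡ x → m ≡ k
sf-level-unique (inj₁ refl) (inj₁ refl) refl = refl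
sf-level-unique (inj₂ refl) (inj₂ refl) refl = refl

module SFFactor {n j α x β k}
  (cs+α∈ : InIdeal n ((c j n ∷ s n ∷ []) ∷ α ∷ []))
  (x∷β↭α : x ∷ β ↭ α) (x-sf : x ≡ s k ⊎ x ≡ f k) (β-sf-free : weight sfDegree β ≡ 0)
  where

  sfWeight-α : ∀ g → weight (sfWeight g) α ≡ g k
  sfWeight-α g = begin
    weight (sfWeight g) α                 ≡⟨ weight-↭ (sfWeight g) x∷β↭α ⟨
    sfWeight g x + weight (sfWeight g) β  ≡⟨ cong₂ _+_ (sfWeight-sf g x-sf) (sfDegree≡0⇒sfWeight≡0 g β β-sf-free) ⟩
    g k + 0                               ≡⟨ +-identityʳ (g k) ⟩
    g k                                   ∎
    where open ≡-Reasoning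

  c-count : ∀ i → weight (cWeight i) α + 𝟙 (i <ᵇ k) ≡ 𝟙 (i <ᵇ suc n)
  c-count i = begin
    weight (cWeight i) α + 𝟙 (i <ᵇ k)             ≡⟨ cong (weight (cWeight i) α +_) (sfWeight-α _) ⟨
    weight (cWeight i) α + weight (sfWeight _) α  ≡⟨ weight-+ (cWeight i) _ α ⟨
    weight (cLevel i) α                           ≡⟨ InIdeal⇒weight≡ (cLevel-homogeneous i) cs+α∈ ⟨
    weight (cLevel i) (c j n ∷ s n ∷ [])          ≡⟨ cLevel-c∷s≡s i j n ⟩
    weight (cLevel i) (s (suc n) ∷ [])            ≡⟨ +-identityʳ _ ⟩
    𝟙 (i <ᵇ suc n)                                ∎
    where open ≡-Reasoning

  q-count : ∀ i → weight (qWeight i) α + 𝟙 (i <ᵇ suc k) ≡ 𝟙 (i <ᵇ suc n)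
  q-count i = begin
    weight (qWeight i) α + 𝟙 (i <ᵇ suc k)         ≡⟨ cong (weight (qWeight i) α +_) (sfWeight-α _) ⟨
    weight (qWeight i) α + weight (sfWeight _) α  ≡⟨ weight-+ (qWeight i) _ α ⟨
    weight (qLevel i) α                           ≡⟨ InIdeal⇒weight≡ (qLevel-homogeneous i) cs+α∈ ⟨
    weight (qLevel i) (c j n ∷ s n ∷ [])          ≡⟨ +-identityʳ _ ⟩
    𝟙 (i <ᵇ suc n)                                ∎
    where open ≡-Reasoning

  k≤n : k ≤ n
  k≤n = s≤s⁻¹ (below⇒< (q-count k) (n<1+n k))

  c-unique : ∀ m → k ≤ m → m ≤ n → UniqueFin4 (λ l → (c l m ∷ []) ∣ₘ α)
  c-unique m k≤m m≤n = weight≡1⇒UniqueFin4 (cWeight m) (λ l → c l m) (λ { refl → refl })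
    (cWeight-positive m) cWeight-support (between⇒≡1 (c-count m) k≤m (s≤s m≤n))

  q-unique : ∀ m → k < m → m ≤ n → UniqueFin4 (λ l → (q l m ∷ []) ∣ₘ α)
  q-unique m k<m m≤n = weight≡1⇒UniqueFin4 (qWeight m) (λ l → q l m) (λ { refl → refl })
    (qWeight-positive m) qWeight-support (between⇒≡1 (q-count m) k<m (s≤s m≤n))

  height : IsHeight α k
  height with c-unique k ≤-refl k≤n
  ... | l , clk∣α , _ = (l , clk∣α) , minimal
    where
    minimal : ∀ i l → (c l i ∷ []) ∣ₘ α → k ≤ i
    minimal i l cli∣α = ≮⇒≥ λ i<k →
      weight≡0⇒∉ (cWeight i) (below⇒≡0 {b = suc n} (c-count i) i<k) (cWeight-positive i l) (∣ₘ⇒∈ cli∣α)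

  x-squarefree : ∀ y → y ≡ s k ⊎ y ≡ f k → ¬ ((x ∷ y ∷ []) ∣ₘ α)
  x-squarefree y y-sf (δ , x∷y∷δ↭α) =
    weight≡0⇒∉ sfDegree β-sf-free (≤-reflexive (sym (sfWeight-sf _ y-sf)))
      (∈-resp-↭ (drop-∷ (↭-trans x∷y∷δ↭α (↭-sym x∷β↭α))) (here refl))

  sf-only-at-k : ∀ m → m ≢ k → ¬ ((s m ∷ []) ∣ₘ α) × ¬ ((f m ∷ []) ∣ₘ α)
  sf-only-at-k m m≢k = absent (inj₁ refl) , absent (inj₂ refl)
    where
    absent : ∀ {y} → y ≡ s m ⊎ y ≡ f m → ¬ ((y ∷ []) ∣ₘ α)
    absent y-sf y∣α = m≢k (sf-level-unique x-sf y-sf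
      (split-unique sfDegree x∷β↭α β-sf-free (≤-reflexive (sym (sfWeight-sf _ y-sf))) (∣ₘ⇒∈ y∣α)))

lemma6p1 : (n : ℕ) (j : Fin 4) (α : Mono) →
    InIdeal n ((c j n ∷ s n ∷ []) ∷ α ∷ []) →
    Σ ℕ λ k → IsHeight α k
      × (∀ m → k ≤ m → m ≤ n → UniqueFin4 (λ l → (c l m ∷ []) ∣ₘ α))
      × (∀ m → k < m → m ≤ n → UniqueFin4 (λ l → (q l m ∷ []) ∣ₘ α))
      × (Σ Var (λ x → (x ≡ s k ⊎ x ≡ f k) × (x ∷ []) ∣ₘ α
           × (∀ y → (y ≡ s k ⊎ y ≡ f k) → ¬ ((x ∷ y ∷ []) ∣ₘ α))))
      × (∀ m → m ≢ k → ¬ ((s m ∷ []) ∣ₘ α) × ¬ ((f m ∷ []) ∣ₘ α))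
lemma6p1 n j α cs+α∈
  with weight≡1⇒split sfDegree α (sym (InIdeal⇒weight≡ sfDegree-homogeneous cs+α∈))
... | x , β , x∷β↭α , x-degree≡1 , β-sf-free with sfDegree-support x-degree≡1
...   | k , x-sf =
  k , height , c-unique , q-unique , (x , x-sf , (β , x∷β↭α) , x-squarefree) , sf-only-at-k
  where open SFFactor cs+α∈ x∷β↭α x-sf β-sf-free
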